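{- Let $R$ be a commutative ring and $E$ a set of $w\ge 3$ distinct non-trivial idempotents of $R$ such that $eR$ is a maximal ideal of $R$ for every $e\in E$. Let $x=f_1f_2\cdots f_k$ and $y=b_1b_2\cdots b_j$ with $f_1,\dots,f_k,b_1,\dots,b_j\in E$ and $2\le k,j<w$. Then (1) $x\neq 0$; and (2) $x=y$ if and only if $\{f_1,\dots,f_k\}=\{b_1,\dots,b_j\}$.
   Context: Rings have $1\neq0$. An idempotent is an element $e$ with $e^2=e$; it is non-trivial if $e\neq0,1$. -}

module Defs where

open import Level using (Level; _⊔_)
open import Algebra.Bundles using (CommutativeRing)
open import Data.Nat using (ℕ; zero; suc)
open import Data.Fin using (Fin; zero; suc)
open import Data.Product using (Σ; ∃; _×_; _,_)
open import Data.Sum using (_⊎_)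
open import Relation.Nullary using (¬_)

module _ {c ℓ : Level} (R : CommutativeRing c ℓ) where
  open CommutativeRing R using (Carrier; _≈_; _+_; _*_; 0#; 1#)

  record IsIdeal (I : Carrier → Set (c ⊔ ℓ)) : Set (c ⊔ ℓ) where
    field
      resp  : ∀ {x y} → x ≈ y → I x → I y
      zero∈ : I 0#
      +-closed : ∀ {x y} → I x → I y → I (x + y)
      *-closed : ∀ r {x} → I x → I (r * x)

  principal : Carrier → Carrier → Set (c ⊔ ℓ)
  principal e x = ∃ λ r → x ≈ e * r

  IsMaximalIdeal : (Carrier → Set (c ⊔ ℓ)) → Set _
  IsMaximalIdeal I =
    IsIdeal I
    × ¬ (∀ x → I x)
    × (∀ (J : Carrier → Set (c ⊔ ℓ)) → IsIdeal J → (∀ x → I x → J x) →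
         (∀ x → J x → I x) ⊎ (∀ x → J x))

  IsIdempotent : Carrier → Set ℓ
  IsIdempotent e = e * e ≈ e

  NonTrivialIdempotent : Carrier → Set ℓ
  NonTrivialIdempotent e = IsIdempotent e × ¬ (e ≈ 0#) × ¬ (e ≈ 1#)

  prod : ∀ {k} → (Fin k → Carrier) → Carrier
  prod {zero}  f = 1#
  prod {suc k} f = f zero * prod (λ i → f (suc i))

  SameSet : ∀ {k j} → (Fin k → Carrier) → (Fin j → Carrier) → Set ℓ
  SameSet f g = (∀ i → ∃ λ l → f i ≈ g l) × (∀ l → ∃ λ i → g l ≈ f i)

module Submission where

-- Call e and g *comaximal* when e + g = 1 + e g, i.e. (1 - e)(1 - g) = 0.
-- The proof rests on three facts about a commutative ring R:
--   * if eR and gR are distinct maximal ideals generated by idempotents,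
--     then eR + gR = R, and this forces e and g to be comaximal;
--   * comaximality with every factor passes to a product, and an element x
--     comaximal with P that also absorbs P (x P = P) must be 1;
--   * an idempotent occurring among the factors of P absorbs P.
-- Hence an idempotent E a whose index does not occur in f cannot absorb
-- x = prod (E ∘ f).  Since k < w such an index exists, and 0 would be
-- absorbed, so x ≠ 0.  If x = y then every factor of x absorbs y, so it
-- occurs in y, and symmetrically; conversely equal sets of idempotent
-- factors give x = x y = y.

open import Defs
open import Level using (Level; _⊔_)
open import Algebra.Bundles using (CommutativeRing)
open import Data.Nat using (ℕ; _≤_; _<_)
open import Data.Fin using (Fin; zero; suc; _≟_)
open import Data.Fin.Properties using (any?; ¬∀⟶∃¬; pigeonhole; <-irrefl)
open import Data.Product using (_×_; _,_; ∃; ∃₂; proj₁; proj₂)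
open import Data.Sum using (_⊎_; inj₁; inj₂)
open import Relation.Nullary using (¬_; yes; no; contradiction)
open import Function.Bundles using (_⇔_; mk⇔)
import Relation.Binary.PropositionalEquality as ≡
open ≡ using (_≡_)

missed-value : ∀ {k w} → k < w → (f : Fin k → Fin w) → ∃ λ a → ∀ i → ¬ (f i ≡ a)
missed-value {k} {w} k<w f
  with ¬∀⟶∃¬ w (λ a → ∃ λ i → f i ≡ a) (λ a → any? (λ i → f i ≟ a)) not-onto
  where
  not-onto : ¬ (∀ a → ∃ λ i → f i ≡ a)
  not-onto onto with pigeonhole k<w (λ a → proj₁ (onto a))
  ... | a , a′ , a<a′ , same-preimage =
    <-irrefl (≡.trans (≡.sym (proj₂ (onto a)))
               (≡.trans (≡.cong f same-preimage) (proj₂ (onto a′)))) a<a′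
... | a , unreached = a , λ i fi≡a → unreached (i , fi≡a)

module _ {c ℓ : Level} (R : CommutativeRing c ℓ) where
  open CommutativeRing R hiding (zero)
  open import Algebra.Solver.Ring.NaturalCoefficients.Default commutativeSemiring
  open import Algebra.Properties.Group +-group using (∙-cancelˡ; ∙-cancelʳ)
  open import Relation.Binary.Reasoning.Setoid setoid

  Comaximal : Carrier → Carrier → Set ℓ
  Comaximal e g = e + g ≈ 1# + e * g

  ValuesIn : ∀ {k j} → (Fin k → Carrier) → (Fin j → Carrier) → Set ℓ
  ValuesIn h g = ∀ l → ∃ λ i → h l ≈ g i

  SumIdeal : Carrier → Carrier → Carrier → Set (c ⊔ ℓ)
  SumIdeal e g x = ∃₂ λ r s → x ≈ e * r + g * s

  sumIdeal-isIdeal : ∀ e g → IsIdeal R (SumIdeal e g)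
  sumIdeal-isIdeal e g = record
    { resp     = λ { x≈y (r , s , x≈) → r , s , trans (sym x≈y) x≈ }
    ; zero∈    = 0# , 0# , solve 2 (λ e g → con 0 := e :* con 0 :+ g :* con 0) refl e g
    ; +-closed = λ { (r , s , x≈) (r′ , s′ , y≈) → r + r′ , s + s′ , trans (+-cong x≈ y≈)
        (solve 6 (λ e g r s r′ s′ → (e :* r :+ g :* s) :+ (e :* r′ :+ g :* s′)
                                    := e :* (r :+ r′) :+ g :* (s :+ s′)) refl e g r s r′ s′) }
    ; *-closed = λ { t (r , s , x≈) → t * r , t * s , trans (*-cong refl x≈)
        (solve 5 (λ e g t r s → t :* (e :* r :+ g :* s) := e :* (t :* r) :+ g :* (t :* s))
                 refl e g t r s) }
    }

  principal⊆sumˡ : ∀ e g x → principal R e x → SumIdeal e g x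
  principal⊆sumˡ e g x (r , x≈) =
    r , 0# , trans x≈ (solve 3 (λ e g r → e :* r := e :* r :+ g :* con 0) refl e g r)

  principal⊆sumʳ : ∀ e g x → principal R g x → SumIdeal e g x
  principal⊆sumʳ e g x (s , x≈) =
    0# , s , trans x≈ (solve 3 (λ e g s → g :* s := e :* con 0 :+ g :* s) refl e g s)

  idempotent-fixes-principal : ∀ {e x} → IsIdempotent R e → principal R e x → e * x ≈ x
  idempotent-fixes-principal {e} {x} ee≈e (r , x≈er) = begin
    e * x        ≈⟨ *-cong refl x≈er ⟩
    e * (e * r)  ≈⟨ *-assoc e e r ⟨
    (e * e) * r  ≈⟨ *-cong ee≈e refl ⟩
    e * r        ≈⟨ x≈er ⟨
    x            ∎

  idempotents-same-ideal : ∀ {e g} → IsIdempotent R e → IsIdempotent R g →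
    principal R g e → principal R e g → e ≈ g
  idempotents-same-ideal {e} {g} ee≈e gg≈g e∈gR g∈eR = begin
    e      ≈⟨ idempotent-fixes-principal gg≈g e∈gR ⟨
    g * e  ≈⟨ *-comm g e ⟩
    e * g  ≈⟨ idempotent-fixes-principal ee≈e g∈eR ⟩
    g      ∎

  -- If 1 ∈ eR + gR for idempotents e, g, they are comaximal: both sides of
  -- e + g = 1 + e g equal (e r + g s) + e g (r + s) when 1 = e r + g s.
  unit-in-sum⇒comaximal : ∀ {e g} → IsIdempotent R e → IsIdempotent R g →
    SumIdeal e g 1# → Comaximal e g
  unit-in-sum⇒comaximal {e} {g} ee≈e gg≈g (r , s , 1≈) = trans lhs≈ (sym rhs≈)
    where
    common : Carrier
    common = (e * r + g * s) + e * g * (r + s)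

    lhs≈ : e + g ≈ common
    lhs≈ = begin
      e + g                                         ≈⟨ *-identityʳ (e + g) ⟨
      (e + g) * 1#                                  ≈⟨ *-cong refl 1≈ ⟩
      (e + g) * (e * r + g * s)                     ≈⟨ solve 4 (λ e g r s →
          (e :+ g) :* (e :* r :+ g :* s)
          := (e :* e) :* r :+ (g :* g) :* s :+ e :* g :* (r :+ s)) refl e g r s ⟩
      (e * e) * r + (g * g) * s + e * g * (r + s)   ≈⟨ +-cong (+-cong (*-cong ee≈e refl)
                                                                    (*-cong gg≈g refl)) refl ⟩
      common                                        ∎

    rhs≈ : 1# + e * g ≈ common
    rhs≈ = begin
      1# + e * g                                    ≈⟨ *-identityʳ (1# + e * g) ⟨
      (1# + e * g) * 1#                             ≈⟨ *-cong refl 1≈ ⟩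
      (1# + e * g) * (e * r + g * s)                ≈⟨ solve 4 (λ e g r s →
          (con 1 :+ e :* g) :* (e :* r :+ g :* s)
          := e :* r :+ g :* s :+ (e :* e) :* g :* r :+ e :* (g :* g) :* s) refl e g r s ⟩
      e * r + g * s + (e * e) * g * r + e * (g * g) * s
        ≈⟨ +-cong (+-cong refl (*-cong (*-cong ee≈e refl) refl))
                  (*-cong (*-cong refl gg≈g) refl) ⟩
      e * r + g * s + e * g * r + e * g * s         ≈⟨ solve 4 (λ e g r s →
          e :* r :+ g :* s :+ e :* g :* r :+ e :* g :* s
          := (e :* r :+ g :* s) :+ e :* g :* (r :+ s)) refl e g r s ⟩
      common                                        ∎

  -- Distinct maximal ideals eR ≠ gR generated by idempotents are comaximal:
  -- eR + gR contains both, so by maximality it is R, or else it lies in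
  -- both eR and gR, which forces e = g.
  maximal-idempotents-comaximal : ∀ {e g} → IsIdempotent R e → IsIdempotent R g →
    IsMaximalIdeal R (principal R e) → IsMaximalIdeal R (principal R g) →
    ¬ (e ≈ g) → Comaximal e g
  maximal-idempotents-comaximal {e} {g} ee≈e gg≈g (_ , _ , max-e) (_ , _ , max-g) e≉g =
    by-maximality (max-e J J-ideal (principal⊆sumˡ e g)) (max-g J J-ideal (principal⊆sumʳ e g))
    where
    J : Carrier → Set (c ⊔ ℓ)
    J = SumIdeal e g
    J-ideal : IsIdeal R J
    J-ideal = sumIdeal-isIdeal e g
    by-maximality : (∀ x → J x → principal R e x) ⊎ (∀ x → J x) →
                    (∀ x → J x → principal R g x) ⊎ (∀ x → J x) → Comaximal e g
    by-maximality (inj₂ J≡R) _ = unit-in-sum⇒comaximal ee≈e gg≈g (J≡R 1#)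
    by-maximality (inj₁ _) (inj₂ J≡R) = unit-in-sum⇒comaximal ee≈e gg≈g (J≡R 1#)
    by-maximality (inj₁ J⊆eR) (inj₁ J⊆gR) = contradiction
      (idempotents-same-ideal ee≈e gg≈g
        (J⊆gR e (principal⊆sumˡ e g e (1# , sym (*-identityʳ e))))
        (J⊆eR g (principal⊆sumʳ e g g (1# , sym (*-identityʳ g)))))
      e≉g

  -- Comaximality with every factor passes to the product (no idempotence
  -- needed): from (1 - x)(1 - g₀) = 0 and (1 - x)(1 - P) = 0 follows
  -- (1 - x)(1 - g₀ P) = 0.
  comaximal-prod : ∀ {k} (x : Carrier) (g : Fin k → Carrier) →
    (∀ i → Comaximal x (g i)) → Comaximal x (prod R g)
  comaximal-prod {ℕ.zero} x g _ = solve 1 (λ x → x :+ con 1 := con 1 :+ x :* con 1) refl x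
  comaximal-prod {ℕ.suc k} x g comax = ∙-cancelˡ (x * P) (x + g₀ * P) (1# + x * (g₀ * P)) (begin
    x * P + (x + g₀ * P)          ≈⟨ solve 3 (λ x g₀ P → x :* P :+ (x :+ g₀ :* P)
                                              := x :+ (x :+ g₀) :* P) refl x g₀ P ⟩
    x + (x + g₀) * P              ≈⟨ +-cong refl (*-cong (comax zero) refl) ⟩
    x + (1# + x * g₀) * P         ≈⟨ solve 3 (λ x g₀ P → x :+ (con 1 :+ x :* g₀) :* P
                                              := (x :+ P) :+ x :* (g₀ :* P)) refl x g₀ P ⟩
    (x + P) + x * (g₀ * P)        ≈⟨ +-cong (comaximal-prod x (λ i → g (suc i)) (λ i → comax (suc i))) refl ⟩
    (1# + x * P) + x * (g₀ * P)   ≈⟨ solve 3 (λ x g₀ P → (con 1 :+ x :* P) :+ x :* (g₀ :* P)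
                                              := x :* P :+ (con 1 :+ x :* (g₀ :* P))) refl x g₀ P ⟩
    x * P + (1# + x * (g₀ * P))   ∎)
    where
    g₀ P : Carrier
    g₀ = g zero
    P = prod R (λ i → g (suc i))

  -- An element comaximal with P that absorbs P is 1:
  -- x + P = 1 + x P = 1 + P.
  comaximal-absorbing⇒one : ∀ {x P} → Comaximal x P → x * P ≈ P → x ≈ 1#
  comaximal-absorbing⇒one {x} {P} comax xP≈P = ∙-cancelʳ P x 1# (begin
    x + P       ≈⟨ comax ⟩
    1# + x * P  ≈⟨ +-cong refl xP≈P ⟩
    1# + P      ∎)

  occurring-idempotent-absorbs : ∀ {k} {x : Carrier} (g : Fin k → Carrier) →
    IsIdempotent R x → (∃ λ i → x ≈ g i) → x * prod R g ≈ prod R g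
  occurring-idempotent-absorbs {x = x} g xx≈x (zero , x≈g₀) = begin
    x * (g zero * P)  ≈⟨ *-cong refl (*-cong (sym x≈g₀) refl) ⟩
    x * (x * P)       ≈⟨ *-assoc x x P ⟨
    (x * x) * P       ≈⟨ *-cong (trans xx≈x x≈g₀) refl ⟩
    g zero * P        ∎
    where
    P : Carrier
    P = prod R (λ i → g (suc i))
  occurring-idempotent-absorbs {x = x} g xx≈x (suc i , x≈gi) = begin
    x * (g zero * P)  ≈⟨ solve 3 (λ x g₀ P → x :* (g₀ :* P) := g₀ :* (x :* P)) refl x (g zero) P ⟩
    g zero * (x * P)  ≈⟨ *-cong refl (occurring-idempotent-absorbs (λ i → g (suc i)) xx≈x (i , x≈gi)) ⟩
    g zero * P        ∎
    where
    P : Carrier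
    P = prod R (λ i → g (suc i))

  absorbs-product-of-values : ∀ {k j} (g : Fin k → Carrier) (h : Fin j → Carrier) →
    (∀ l → IsIdempotent R (h l)) → ValuesIn h g → prod R g * prod R h ≈ prod R g
  absorbs-product-of-values {j = ℕ.zero} g h _ _ = *-identityʳ (prod R g)
  absorbs-product-of-values {j = ℕ.suc j} g h idem h⊆g = begin
    P * (h zero * Q)  ≈⟨ solve 3 (λ P h₀ Q → P :* (h₀ :* Q) := (h₀ :* P) :* Q) refl P (h zero) Q ⟩
    (h zero * P) * Q  ≈⟨ *-cong (occurring-idempotent-absorbs g (idem zero) (h⊆g zero)) refl ⟩
    P * Q             ≈⟨ absorbs-product-of-values g (λ l → h (suc l)) (λ l → idem (suc l)) (λ l → h⊆g (suc l)) ⟩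
    P                 ∎
    where
    P Q : Carrier
    P = prod R g
    Q = prod R (λ l → h (suc l))

  same-values⇒same-product : ∀ {k j} (g : Fin k → Carrier) (h : Fin j → Carrier) →
    (∀ i → IsIdempotent R (g i)) → (∀ l → IsIdempotent R (h l)) →
    SameSet R g h → prod R g ≈ prod R h
  same-values⇒same-product g h idem-g idem-h (g⊆h , h⊆g) = begin
    prod R g             ≈⟨ absorbs-product-of-values g h idem-h h⊆g ⟨
    prod R g * prod R h  ≈⟨ *-comm (prod R g) (prod R h) ⟩
    prod R h * prod R g  ≈⟨ absorbs-product-of-values h g idem-g g⊆h ⟩
    prod R h             ∎

  module _ {w : ℕ} (E : Fin w → Carrier) (E-injective : ∀ a b → E a ≈ E b → a ≡ b)
           (nontrivial : ∀ a → NonTrivialIdempotent R (E a))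
           (maximal : ∀ a → IsMaximalIdeal R (principal R (E a))) where

    -- E a with a outside the image of f cannot absorb prod (E ∘ f), since
    -- it is comaximal with every factor and differs from 1.
    absent-idempotent-not-absorbing : ∀ {k} (f : Fin k → Fin w) (a : Fin w) →
      (∀ i → ¬ (f i ≡ a)) → ¬ (E a * prod R (λ i → E (f i)) ≈ prod R (λ i → E (f i)))
    absent-idempotent-not-absorbing f a a∉f absorbs =
      proj₂ (proj₂ (nontrivial a)) (comaximal-absorbing⇒one
        (comaximal-prod (E a) (λ i → E (f i)) λ i →
          maximal-idempotents-comaximal (proj₁ (nontrivial a)) (proj₁ (nontrivial (f i)))
            (maximal a) (maximal (f i)) (λ Ea≈Efi → a∉f i (≡.sym (E-injective a (f i) Ea≈Efi))))
        absorbs)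

    product-nonzero : ∀ {k} → k < w → (f : Fin k → Fin w) → ¬ (prod R (λ i → E (f i)) ≈ 0#)
    product-nonzero k<w f P≈0 with missed-value k<w f
    ... | a , a∉f = absent-idempotent-not-absorbing f a a∉f (begin
      E a * P   ≈⟨ *-cong refl P≈0 ⟩
      E a * 0#  ≈⟨ zeroʳ (E a) ⟩
      0#        ≈⟨ P≈0 ⟨
      P         ∎)
      where
      P : Carrier
      P = prod R (λ i → E (f i))

    -- Equal products have the same factors: a factor E (f i) absorbs
    -- prod (E ∘ f) = prod (E ∘ b), so its index must occur in b.
    same-product⇒values-in : ∀ {k j} (f : Fin k → Fin w) (b : Fin j → Fin w) →
      prod R (λ i → E (f i)) ≈ prod R (λ l → E (b l)) →
      ValuesIn (λ i → E (f i)) (λ l → E (b l))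
    same-product⇒values-in f b Pf≈Pb i with any? (λ l → b l ≟ f i)
    ... | yes (l , bl≡fi) = l , reflexive (≡.cong E (≡.sym bl≡fi))
    ... | no fi∉b = contradiction (begin
      E (f i) * Pb  ≈⟨ *-cong refl Pf≈Pb ⟨
      E (f i) * Pf  ≈⟨ occurring-idempotent-absorbs (λ i → E (f i)) (proj₁ (nontrivial (f i))) (i , refl) ⟩
      Pf            ≈⟨ Pf≈Pb ⟩
      Pb            ∎)
      (absent-idempotent-not-absorbing b (f i) (λ l bl≡fi → fi∉b (l , bl≡fi)))
      where
      Pf Pb : Carrier
      Pf = prod R (λ i → E (f i))
      Pb = prod R (λ l → E (b l))

lemma3p20 : ∀ {c ℓ : Level} (R : CommutativeRing c ℓ) →
    let open CommutativeRing R in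
    ¬ (1# ≈ 0#) →
    (w : ℕ) → 3 ≤ w →
    (E : Fin w → Carrier) →
    (∀ a b → E a ≈ E b → a ≡ b) →
    (∀ a → NonTrivialIdempotent R (E a)) →
    (∀ a → IsMaximalIdeal R (principal R (E a))) →
    (k j : ℕ) → 2 ≤ k → k < w → 2 ≤ j → j < w →
    (f : Fin k → Fin w) → (b : Fin j → Fin w) →
    ¬ (prod R (λ i → E (f i)) ≈ 0#)
    × ((prod R (λ i → E (f i)) ≈ prod R (λ i → E (b i)))
    ⇔ SameSet R (λ i → E (f i)) (λ i → E (b i)))
lemma3p20 R _ w _ E E-injective nontrivial maximal k j _ k<w _ _ f b =
  product-nonzero R E E-injective nontrivial maximal k<w f ,
  mk⇔ (λ Pf≈Pb → values-in f b Pf≈Pb , values-in b f (sym Pf≈Pb))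
      (same-values⇒same-product R (λ i → E (f i)) (λ l → E (b l))
        (λ i → idempotent (f i)) (λ l → idempotent (b l)))
  where
  open CommutativeRing R using (_≈_; sym)
  values-in : ∀ {k j} (f : Fin k → Fin w) (b : Fin j → Fin w) →
    prod R (λ i → E (f i)) ≈ prod R (λ l → E (b l)) →
    ValuesIn R (λ i → E (f i)) (λ l → E (b l))
  values-in = same-product⇒values-in R E E-injective nontrivial maximal
  idempotent : ∀ a → IsIdempotent R (E a)
  idempotent a = proj₁ (nontrivial a)
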